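{- If $m\geq 8$ and $n\equiv 1\pmod 3$ (with $n\geq 1$ an integer), then $\mbox{min-seed}(C_m\oslash C_n,3)\leq \frac{mn}{3}+\frac{m}{6}+1$.
   Context: The $m\times n$ torus cordalis $C_m\oslash C_n$ has vertex set $\{(i,j):1\leq i\leq m,\ 1\leq j\leq n\}$; its edges are those of the toroidal mesh $C_m\Box C_n$ (where $(i,j)$ is adjacent to $(i\pm1,j)$ and $(i,j\pm1)$, first coordinate modulo $m$, second modulo $n$), except that for each $1\leq i\leq m$ the edge $(i,n)(i,1)$ is replaced by the edge $(i,n)(i+1,1)$ (first coordinate modulo $m$). For a graph $G$ and positive integer $k$, the activation process in $(G,k)$ starting at $S\subseteq V(G)$: at time $0$ exactly the vertices of $S$ are active; at each subsequent step every inactive vertex with at least $k$ active neighbors becomes active; active vertices stay active; the process stops when nothing changes. $\mbox{min-seed}(G,k)$ is the minimum size of a set $S\subseteq V(G)$ such that at the end of this process all vertices of $G$ are active. -}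

module Defs where

open import Data.Nat using (ℕ; zero; suc; _+_; _*_; _≤_; _≤ᵇ_)
open import Data.Fin using (Fin; zero; suc; fromℕ; inject₁)
open import Data.Bool using (Bool; true; false; _∨_; if_then_else_)
open import Data.Maybe using (Maybe; just; nothing; maybe′)
import Data.Maybe as Maybe
open import Data.List using (List; _∷_; []; map; allFin)
open import Data.Nat.ListAction using (sum)
open import Data.Product using (_×_; _,_; Σ)
open import Relation.Binary.PropositionalEquality using (_≡_)

-- Vertices of C_m ⊘ C_n are pairs (i , j) : Fin m × Fin n  (0-indexed:
-- paper's (i,j) corresponds to (i-1 , j-1)).

nextF : ∀ {n} → Fin n → Maybe (Fin n)
nextF {suc zero} zero = nothing
nextF {suc (suc n)} zero = just (suc zero)
nextF {suc (suc n)} (suc j) = Maybe.map suc (nextF j)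

prevF : ∀ {n} → Fin n → Maybe (Fin n)
prevF zero = nothing
prevF (suc j) = just (inject₁ j)

firstF : ∀ {n} → Fin n → Fin n
firstF {suc n} _ = zero

lastF : ∀ {n} → Fin n → Fin n
lastF {suc n} _ = fromℕ n

sucMod : ∀ {n} → Fin n → Fin n
sucMod i = maybe′ (λ x → x) (firstF i) (nextF i)

predMod : ∀ {n} → Fin n → Fin n
predMod i = maybe′ (λ x → x) (lastF i) (prevF i)

Vertex : ℕ → ℕ → Set
Vertex m n = Fin m × Fin n

-- The four neighbours of (i , j) in the torus cordalis C_m ⊘ C_n
-- (listed with multiplicity; for n ≥ 2 and m ≥ 3 they are pairwise distinct):
--   (i+1 , j), (i-1 , j)                       (vertical edges, i mod m)
--   (i , j+1)     if j is not the last column, else (i+1 , 0)   (cordal edge)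
--   (i , j-1)     if j is not the first column, else (i-1 , n-1)
neighbours : ∀ {m n} → Vertex m n → List (Vertex m n)
neighbours (i , j) =
  (sucMod i , j) ∷ (predMod i , j) ∷
  maybe′ (λ j′ → (i , j′)) (sucMod i , firstF j) (nextF j) ∷
  maybe′ (λ j′ → (i , j′)) (predMod i , lastF j) (prevF j) ∷ []

VSet : ℕ → ℕ → Set
VSet m n = Vertex m n → Bool

toℕᵇ : Bool → ℕ
toℕᵇ true = 1
toℕᵇ false = 0

size : ∀ {m n} → VSet m n → ℕ
size {m} {n} S = sum (map (λ i → sum (map (λ j → toℕᵇ (S (i , j))) (allFin n))) (allFin m))

activeNbrs : ∀ {m n} → VSet m n → Vertex m n → ℕ
activeNbrs A v = sum (map (λ u → toℕᵇ (A u)) (neighbours v))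

active : ∀ {m n} → ℕ → VSet m n → ℕ → VSet m n
active k S zero v = S v
active k S (suc t) v = active k S t v ∨ (k ≤ᵇ activeNbrs (active k S t) v)

-- S activates every vertex (the process is monotone on a finite graph,
-- so "all active at the end" ⇔ "all active at some time t")
Percolates : ∀ {m n} → ℕ → VSet m n → Set
Percolates {m} {n} k S = Σ ℕ (λ t → (v : Vertex m n) → active k S t v ≡ true)

IsMinSeed : ℕ → ℕ → ℕ → ℕ → Set
IsMinSeed m n k s =
  Σ (VSet m n) (λ S → Percolates k S × size S ≡ s) ×
  ((S : VSet m n) → Percolates k S → s ≤ size S)

{-# OPTIONS --safe #-}
-- Write n = 3k + 1 and read column 3q + r as the pair (q , r). Every row gets one of five
-- types: A seeds the columns ≡ 0 (mod 3), B and B′ those ≡ 1, C those ≡ 2, and A₀ is A with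
-- column 1 added. Read cyclically from the top, the row types are A₀ (B A)ʰ B′ C for odd m and
-- A₀ (B A)ʰ B′ C A₀ B′ C for even m, which costs mn/3 + m/6 + O(1) seeds. Percolation is
-- certified by an explicit activation time for every vertex such that each non-seed has three
-- neighbours that are seeds or activate strictly earlier: the blocks of three columns are
-- completed from right to left in waves of length m + 4, and within a wave the residue-2 cells
-- are filled in from the bottom row upwards. For n = 1 each row is joined to each of its two
-- neighbouring rows twice, so seeding every other row suffices.
module Submission where

open import Data.Bool using (Bool; true; false; _∨_; T; if_then_else_)
open import Data.Bool.Properties using (∨-zeroʳ; ∨-identityʳ; T-≡)
open import Data.Empty using (⊥-elim)
open import Data.Fin using (Fin; zero; suc; toℕ; fromℕ; inject₁)
open import Data.Fin.Properties using (toℕ<n; toℕ-fromℕ; toℕ-inject₁)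
open import Data.List using (List; []; _∷_; _++_; length; lookup; map; tabulate; allFin)
open import Data.List.Properties using (map-cong; map-tabulate; tabulate-lookup; map-++; length-++)
open import Data.Maybe using (just; nothing; maybe′)
open import Data.Maybe.Properties using (maybe′-map; maybe′-∘)
open import Data.Nat using (ℕ; zero; suc; _+_; _*_; _∸_; _≤_; _<_; _<ᵇ_; _≡ᵇ_; _⊔_; _%_; _/_; z≤n; s≤s; s≤s⁻¹)
open import Data.Nat.DivMod using (m≡m%n+[m/n]*n; m%n<n)
open import Data.Nat.Induction using (<-rec)
open import Data.Nat.ListAction using (sum)
open import Data.Nat.ListAction.Properties using (sum-++)
open import Data.Nat.Properties
open import Data.Nat.Tactic.RingSolver using (solve-∀)
open import Data.Product using (Σ; _×_; _,_; proj₁; proj₂; map₂)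
open import Data.Sum using (_⊎_; inj₁; inj₂)
open import Function using (_∘_; id; Equivalence)
open import Relation.Binary.PropositionalEquality

open import Defs

nextF-inject₁ : ∀ {n} (j : Fin n) → nextF (inject₁ j) ≡ just (suc j)
nextF-inject₁ {suc n} zero = refl
nextF-inject₁ {suc (suc n)} (suc j) rewrite nextF-inject₁ j = refl

nextF-fromℕ : ∀ n → nextF (fromℕ n) ≡ nothing
nextF-fromℕ zero = refl
nextF-fromℕ (suc n) rewrite nextF-fromℕ n = refl

sucMod-predMod : ∀ {m} (i : Fin m) → sucMod (predMod i) ≡ i
sucMod-predMod {suc m} zero rewrite nextF-fromℕ m = refl
sucMod-predMod (suc i) rewrite nextF-inject₁ i = refl

toℕ-nextF-just : ∀ {n} {j j′ : Fin n} → nextF j ≡ just j′ → toℕ j′ ≡ suc (toℕ j)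
toℕ-nextF-just {suc (suc n)} {zero} refl = refl
toℕ-nextF-just {suc (suc n)} {suc j} eq with nextF j in e
toℕ-nextF-just {suc (suc n)} {suc j} refl | just _ = cong suc (toℕ-nextF-just e)

toℕ-nextF-nothing : ∀ {n} {j : Fin n} → nextF j ≡ nothing → suc (toℕ j) ≡ n
toℕ-nextF-nothing {suc zero} {zero} refl = refl
toℕ-nextF-nothing {suc (suc n)} {suc j} eq with nextF j in e
toℕ-nextF-nothing {suc (suc n)} {suc j} refl | nothing = cong suc (toℕ-nextF-nothing e)

Chain : ∀ {X : Set} → (X → X → Set) → X → X → List X → Set
Chain R z x [] = R x z
Chain R z x (y ∷ ys) = R x y × Chain R z y ys

IsCyclic : ∀ {X : Set} {m} → (X → X → Set) → (Fin m → X) → Set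
IsCyclic R f = ∀ i → R (f i) (f (sucMod i))

module _ {X : Set} {R : X → X → Set} where

  chain-nextF : ∀ {z x xs} → Chain R z x xs → (i : Fin (length (x ∷ xs))) →
                R (lookup (x ∷ xs) i) (maybe′ (lookup (x ∷ xs)) z (nextF i))
  chain-nextF {xs = []} c zero = c
  chain-nextF {xs = y ∷ ys} (r , c) zero = r
  chain-nextF {z} {x} {y ∷ ys} (r , c) (suc i) =
    subst (R _) (sym (maybe′-map (lookup (x ∷ y ∷ ys)) z suc (nextF i))) (chain-nextF {xs = ys} c i)

  chain⇒cyclic : ∀ {x xs} → Chain R x x xs → IsCyclic R (lookup (x ∷ xs))
  chain⇒cyclic {x} {xs} c i =
    subst (R _) (sym (maybe′-∘ {b = zero} (lookup (x ∷ xs)) id (nextF i))) (chain-nextF {xs = xs} c i)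

  cyclic-predMod : ∀ {m} {f : Fin m → X} → IsCyclic R f → ∀ i → R (f (predMod i)) (f i)
  cyclic-predMod {f = f} cyc i = subst (R _) (cong f (sucMod-predMod i)) (cyc (predMod i))

-- Activation schedules

module _ {m n : ℕ} (k : ℕ) (S : VSet m n) where

  active-step : ∀ {t v} → active k S t v ≡ true → active k S (suc t) v ≡ true
  active-step eq rewrite eq = refl

  active-mono : ∀ {t t′ v} → t ≤ t′ → active k S t v ≡ true → active k S t′ v ≡ true
  active-mono {t′ = zero} z≤n act = act
  active-mono {t′ = suc t′} {v} t≤ act with m≤n⇒m<n∨m≡n t≤
  ... | inj₁ t<1+t′ = active-step {t′} {v} (active-mono (s≤s⁻¹ t<1+t′) act)
  ... | inj₂ refl = act

  active-seed : ∀ t {v} → S v ≡ true → active k S t v ≡ true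
  active-seed t {v} = active-mono {0} {t} {v} z≤n

toℕᵇ-mono : ∀ {a b} → (a ≡ true → b ≡ true) → toℕᵇ a ≤ toℕᵇ b
toℕᵇ-mono {false} _ = z≤n
toℕᵇ-mono {true} a⇒b rewrite a⇒b refl = ≤-refl

activeNbrs-mono : ∀ {m n} {A B : VSet m n} → (∀ u → A u ≡ true → B u ≡ true) →
                  ∀ v → activeNbrs A v ≤ activeNbrs B v
activeNbrs-mono {A = A} {B} A⊆B v = go (neighbours v)
  where
    go : ∀ us → sum (map (λ u → toℕᵇ (A u)) us) ≤ sum (map (λ u → toℕᵇ (B u)) us)
    go [] = z≤n
    go (u ∷ us) = +-mono-≤ (toℕᵇ-mono (A⊆B u)) (go us)

Fin-bounded : ∀ {m} (f : Fin m → ℕ) → Σ ℕ λ b → ∀ i → f i ≤ b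
Fin-bounded {zero} f = 0 , λ ()
Fin-bounded {suc m} f with Fin-bounded (f ∘ suc)
... | b , bound = f zero ⊔ b , λ { zero → m≤m⊔n _ b ; (suc i) → ≤-trans (bound i) (m≤n⊔m (f zero) b) }

Vertex-bounded : ∀ {m n} (f : Vertex m n → ℕ) → Σ ℕ λ b → ∀ v → f v ≤ b
Vertex-bounded {m} {n} f = proj₁ rows , λ (i , j) → ≤-trans (proj₂ (row i) j) (proj₂ rows i)
  where
    row : (i : Fin m) → Σ ℕ λ b → ∀ j → f (i , j) ≤ b
    row i = Fin-bounded (λ j → f (i , j))
    rows : Σ ℕ λ b → ∀ i → proj₁ (row i) ≤ b
    rows = Fin-bounded (λ i → proj₁ (row i))

module _ {m n : ℕ} (k : ℕ) (S : VSet m n) (τ : Vertex m n → ℕ) where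

  EarlierThan : Vertex m n → VSet m n
  EarlierThan v u = S u ∨ (τ u <ᵇ τ v)

  IsSchedule : Set
  IsSchedule = ∀ v → S v ≡ false → k ≤ activeNbrs (EarlierThan v) v

  schedule⇒active : IsSchedule → ∀ v → active k S (suc (τ v)) v ≡ true
  schedule⇒active schedule v = <-rec P step (τ v) v refl
    where
      P : ℕ → Set
      P x = ∀ v → τ v ≡ x → active k S (suc x) v ≡ true
      step : ∀ x → (∀ {y} → y < x → P y) → P x
      step _ ih v refl with S v in seed
      ... | true = active-seed k S (suc (τ v)) seed
      ... | false = trans (cong (active k S (τ v) v ∨_) (Equivalence.to T-≡ (≤⇒≤ᵇ enough))) (∨-zeroʳ _)
        where
          earlier⇒active : ∀ u → EarlierThan v u ≡ true → active k S (τ v) u ≡ true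
          earlier⇒active u _ with S u in seedᵤ
          earlier⇒active u _ | true = active-seed k S (τ v) seedᵤ
          earlier⇒active u before | false =
            active-mono k S τᵤ<τᵥ (ih τᵤ<τᵥ u refl)
            where τᵤ<τᵥ = <ᵇ⇒< (τ u) (τ v) (Equivalence.from T-≡ before)
          enough : k ≤ activeNbrs (active k S (τ v)) v
          enough = ≤-trans (schedule v seed) (activeNbrs-mono earlier⇒active v)

  schedule⇒percolates : IsSchedule → Percolates k S
  schedule⇒percolates schedule =
    suc b , λ v → active-mono k S (s≤s (τ≤b v)) (schedule⇒active schedule v)
    where open Σ (Vertex-bounded τ) renaming (proj₁ to b; proj₂ to τ≤b)

south north east west : ∀ {m n} → Vertex m n → Vertex m n
south (i , j) = (sucMod i , j)
north (i , j) = (predMod i , j)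
east (i , j) = maybe′ (λ j′ → (i , j′)) (sucMod i , firstF j) (nextF j)
west (i , j) = maybe′ (λ j′ → (i , j′)) (predMod i , lastF j) (prevF j)

data ThreeOfFour (P Q R T : Set) : Set where
  skip₁ : Q → R → T → ThreeOfFour P Q R T
  skip₂ : P → R → T → ThreeOfFour P Q R T
  skip₃ : P → Q → T → ThreeOfFour P Q R T
  skip₄ : P → Q → R → ThreeOfFour P Q R T

ThreeOfFour-map : ∀ {P Q R T P′ Q′ R′ T′ : Set} → (P → P′) → (Q → Q′) → (R → R′) → (T → T′) →
                  ThreeOfFour P Q R T → ThreeOfFour P′ Q′ R′ T′
ThreeOfFour-map f g h l (skip₁ q r t) = skip₁ (g q) (h r) (l t)
ThreeOfFour-map f g h l (skip₂ p r t) = skip₂ (f p) (h r) (l t)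
ThreeOfFour-map f g h l (skip₃ p q t) = skip₃ (f p) (g q) (l t)
ThreeOfFour-map f g h l (skip₄ p q r) = skip₄ (f p) (g q) (h r)

3≤activeNbrs : ∀ {m n} (A : VSet m n) v →
               ThreeOfFour (A (south v) ≡ true) (A (north v) ≡ true) (A (east v) ≡ true) (A (west v) ≡ true) →
               3 ≤ activeNbrs A v
3≤activeNbrs A v (skip₁ eq₂ eq₃ eq₄) rewrite eq₂ | eq₃ | eq₄ = m≤n+m 3 _
3≤activeNbrs A v (skip₂ eq₁ eq₃ eq₄) rewrite eq₁ | eq₃ | eq₄ = s≤s (m≤n+m 2 _)
3≤activeNbrs A v (skip₃ eq₁ eq₂ eq₄) rewrite eq₁ | eq₂ | eq₄ = s≤s (s≤s (m≤n+m 1 _))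
3≤activeNbrs A v (skip₄ eq₁ eq₂ eq₃) rewrite eq₁ | eq₂ | eq₃ = s≤s (s≤s (s≤s z≤n))

countBelow : (ℕ → Bool) → ℕ → ℕ
countBelow p zero = 0
countBelow p (suc n) = toℕᵇ (p 0) + countBelow (p ∘ suc) n

countBelow-cong : ∀ {p p′} → (∀ b → p b ≡ p′ b) → ∀ n → countBelow p n ≡ countBelow p′ n
countBelow-cong p≗p′ zero = refl
countBelow-cong p≗p′ (suc n) = cong₂ _+_ (cong toℕᵇ (p≗p′ 0)) (countBelow-cong (p≗p′ ∘ suc) n)

sum-tabulate-toℕ : ∀ (p : ℕ → Bool) n → sum (tabulate {n = n} (λ j → toℕᵇ (p (toℕ j)))) ≡ countBelow p n
sum-tabulate-toℕ p zero = refl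
sum-tabulate-toℕ p (suc n) = cong (toℕᵇ (p 0) +_) (sum-tabulate-toℕ (p ∘ suc) n)

rowPatternSet : ∀ {X : Set} {n} (w : List X) → (X → ℕ → Bool) → VSet (length w) n
rowPatternSet w p (i , j) = p (lookup w i) (toℕ j)

size-rowPatternSet : ∀ {X : Set} {n} (w : List X) (p : X → ℕ → Bool) →
                     size (rowPatternSet {n = n} w p) ≡ sum (map (λ x → countBelow (p x) n) w)
size-rowPatternSet {X} {n} w p = cong sum (begin
  map (λ i → sum (map (λ j → toℕᵇ (p (lookup w i) (toℕ j))) (allFin n))) (allFin (length w))
    ≡⟨ map-cong (λ i → trans (cong sum (map-tabulate {n = n} id (λ j → toℕᵇ (p (lookup w i) (toℕ j)))))
                             (sum-tabulate-toℕ (p (lookup w i)) n))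
                (allFin (length w)) ⟩
  map (rowCount ∘ lookup w) (allFin (length w))
    ≡⟨ map-tabulate id (rowCount ∘ lookup w) ⟩
  tabulate (rowCount ∘ lookup w)
    ≡⟨ map-tabulate (lookup w) rowCount ⟨
  map rowCount (tabulate (lookup w))
    ≡⟨ cong (map rowCount) (tabulate-lookup w) ⟩
  map rowCount w ∎)
  where
    open ≡-Reasoning
    rowCount : X → ℕ
    rowCount x = countBelow (p x) n

rowPattern-seed : ∀ {X : Set} {m n} (w : List X) (p : X → ℕ → Bool) → m ≡ length w →
                  Percolates 3 (rowPatternSet {n = n} w p) →
                  Σ (VSet m n) λ S → Percolates 3 S × size S ≡ sum (map (λ x → countBelow (p x) n) w)
rowPattern-seed {n = n} w p refl percolates = rowPatternSet w p , percolates , size-rowPatternSet {n = n} w p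

alternate : ∀ {X : Set} → ℕ → X → X → List X
alternate zero x y = []
alternate (suc h) x y = x ∷ y ∷ alternate h x y

length-alternate : ∀ {X : Set} h (x y : X) → length (alternate h x y) ≡ h * 2
length-alternate zero x y = refl
length-alternate (suc h) x y = cong (λ l → suc (suc l)) (length-alternate h x y)

sum-map-alternate : ∀ {X : Set} (f : X → ℕ) h x y → sum (map f (alternate h x y)) ≡ h * (f x + f y)
sum-map-alternate f zero x y = refl
sum-map-alternate f (suc h) x y = begin
  f x + (f y + sum (map f (alternate h x y))) ≡⟨ +-assoc (f x) (f y) _ ⟨
  f x + f y + sum (map f (alternate h x y))   ≡⟨ cong (f x + f y +_) (sum-map-alternate f h x y) ⟩
  f x + f y + h * (f x + f y)                 ∎
  where open ≡-Reasoning

chain-alternate : ∀ {X : Set} {R : X → X → Set} {x y z} → R y x → R x y → R y z →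
                  ∀ h → Chain R z y (alternate h x y)
chain-alternate yx xy yz zero = yz
chain-alternate yx xy yz (suc h) = yx , xy , chain-alternate yx xy yz h

length-alternate-++ : ∀ {X : Set} h (x y : X) xs → length (alternate h x y ++ xs) ≡ h * 2 + length xs
length-alternate-++ h x y xs = trans (length-++ (alternate h x y)) (cong (_+ length xs) (length-alternate h x y))

sum-map-alternate-++ : ∀ {X : Set} (f : X → ℕ) h x y xs →
                       sum (map f (alternate h x y ++ xs)) ≡ h * (f x + f y) + sum (map f xs)
sum-map-alternate-++ f h x y xs = begin
  sum (map f (alternate h x y ++ xs))             ≡⟨ cong sum (map-++ f (alternate h x y) xs) ⟩
  sum (map f (alternate h x y) ++ map f xs)       ≡⟨ sum-++ (map f (alternate h x y)) (map f xs) ⟩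
  sum (map f (alternate h x y)) + sum (map f xs)  ≡⟨ cong (_+ sum (map f xs)) (sum-map-alternate f h x y) ⟩
  h * (f x + f y) + sum (map f xs)                ∎
  where open ≡-Reasoning

even⊎odd : ∀ m → (Σ ℕ λ p → m ≡ p * 2) ⊎ (Σ ℕ λ p → m ≡ suc (p * 2))
even⊎odd m with m % 2 | m≡m%n+[m/n]*n m 2 | m%n<n m 2
... | 0 | m≡ | _ = inj₁ (m / 2 , m≡)
... | 1 | m≡ | _ = inj₂ (m / 2 , m≡)
... | suc (suc _) | _ | s≤s (s≤s ())

-- A single column

NotBothFalse : Bool → Bool → Set
NotBothFalse x y = x ∨ y ≡ true

singleColumn-percolates : ∀ {m} (f : Fin m → Bool) → IsCyclic NotBothFalse f → Percolates {m} {1} 3 (f ∘ proj₁)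
singleColumn-percolates {m} f cyclic = schedule⇒percolates 3 S (λ _ → 0) schedule
  where
    S : VSet m 1
    S = f ∘ proj₁
    seed⇒early : ∀ {b} → b ≡ true → b ∨ false ≡ true
    seed⇒early refl = refl
    -- With one column, east coincides with south and west with north.
    schedule : IsSchedule 3 S (λ _ → 0)
    schedule (i , zero) seedless =
      3≤activeNbrs (EarlierThan 3 S (λ _ → 0) (i , zero)) (i , zero)
        (skip₁ (seed⇒early above) (seed⇒early below) (seed⇒early above))
      where
        below : f (sucMod i) ≡ true
        below = subst (λ b → b ∨ f (sucMod i) ≡ true) seedless (cyclic i)
        above : f (predMod i) ≡ true
        above = trans (sym (∨-identityʳ _))
                  (subst (λ b → f (predMod i) ∨ b ≡ true) seedless (cyclic-predMod {R = NotBothFalse} {f = f} cyclic i))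

percolatingSet-n≡1 : ∀ m → Σ (VSet m 1) λ S → Percolates 3 S × 2 * size S ≤ 2 + m
percolatingSet-n≡1 m with even⊎odd m
... | inj₁ (zero , refl) = (λ _ → false) , (0 , λ ()) , z≤n
... | inj₁ (suc p , refl) =
  map₂ (map₂ count⇒bound)
       (rowPattern-seed (alternate (suc p) true false) (λ x _ → x) (sym (length-alternate (suc p) true false))
          (singleColumn-percolates _ (chain⇒cyclic {R = NotBothFalse} (refl , chain-alternate refl refl refl p))))
  where
    count⇒bound : ∀ {s} → s ≡ sum (map (λ x → countBelow (λ _ → x) 1) (alternate (suc p) true false)) →
                  2 * s ≤ 2 + suc p * 2
    count⇒bound refl = begin
      2 * sum (map (λ x → countBelow (λ _ → x) 1) (alternate (suc p) true false))
                      ≡⟨ cong (2 *_) (sum-map-alternate (λ x → countBelow (λ _ → x) 1) (suc p) true false) ⟩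
      2 * (suc p * 1) ≡⟨ cong (2 *_) (*-identityʳ (suc p)) ⟩
      2 * suc p       ≡⟨ *-comm 2 (suc p) ⟩
      suc p * 2       ≤⟨ m≤n+m _ 2 ⟩
      2 + suc p * 2   ∎
      where open ≤-Reasoning
... | inj₂ (p , refl) =
  map₂ (map₂ count⇒bound)
       (rowPattern-seed (true ∷ alternate p false true) (λ x _ → x) (cong suc (sym (length-alternate p false true)))
          (singleColumn-percolates _ (chain⇒cyclic {R = NotBothFalse} (chain-alternate refl refl refl p))))
  where
    count⇒bound : ∀ {s} → s ≡ sum (map (λ x → countBelow (λ _ → x) 1) (true ∷ alternate p false true)) →
                  2 * s ≤ 2 + suc (p * 2)
    count⇒bound refl = begin
      2 * (1 + sum (map (λ x → countBelow (λ _ → x) 1) (alternate p false true)))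
                       ≡⟨ cong (λ c → 2 * (1 + c)) (sum-map-alternate (λ x → countBelow (λ _ → x) 1) p false true) ⟩
      2 * (1 + p * 1)  ≡⟨ cong (λ c → 2 * (1 + c)) (*-identityʳ p) ⟩
      2 * (1 + p)      ≡⟨ *-comm 2 (1 + p) ⟩
      2 + p * 2        ≤⟨ n≤1+n _ ⟩
      2 + suc (p * 2)  ∎
      where open ≤-Reasoning

data Residue : Set where
  r₀ r₁ r₂ : Residue

residue : Residue → ℕ
residue r₀ = 0
residue r₁ = 1
residue r₂ = 2

Column : Set
Column = ℕ × Residue

index : Column → ℕ
index (q , r) = residue r + q * 3

nextColumn : Column → Column
nextColumn (q , r₀) = (q , r₁)
nextColumn (q , r₁) = (q , r₂)
nextColumn (q , r₂) = (suc q , r₀)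

column : ℕ → Column
column zero = (0 , r₀)
column (suc b) = nextColumn (column b)

index-column : ∀ b → index (column b) ≡ b
index-column zero = refl
index-column (suc b) with column b | index-column b
... | (q , r₀) | refl = refl
... | (q , r₁) | refl = refl
... | (q , r₂) | refl = refl

column-*3 : ∀ q → column (q * 3) ≡ (q , r₀)
column-*3 zero = refl
column-*3 (suc q) rewrite column-*3 q = refl

Cell : ℕ → Set
Cell m = Fin m × Column

cell : ∀ {m n} → Vertex m n → Cell m
cell (i , j) = (i , column (toℕ j))

module _ {m : ℕ} (k : ℕ) where

  eastCell : Cell m → Cell m
  eastCell (i , q , r₀) = if q ≡ᵇ k then (sucMod i , 0 , r₀) else (i , q , r₁)
  eastCell (i , q , r₁) = (i , q , r₂)
  eastCell (i , q , r₂) = (i , suc q , r₀)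

  westCell : Cell m → Cell m
  westCell (i , q , r₁) = (i , q , r₀)
  westCell (i , q , r₂) = (i , q , r₁)
  westCell (i , zero , r₀) = (predMod i , k , r₀)
  westCell (i , suc q , r₀) = (i , q , r₂)

  eastCell-r₀ : ∀ (P : Cell m → Set) i q → (q ≡ k → P (sucMod i , 0 , r₀)) → (q ≢ k → P (i , q , r₁)) →
                P (eastCell (i , q , r₀))
  eastCell-r₀ P i q last notLast with q ≡ᵇ k in q≡ᵇk
  ... | true = last (≡ᵇ⇒≡ q k (Equivalence.from T-≡ q≡ᵇk))
  ... | false = notLast (λ q≡k → subst T q≡ᵇk (≡⇒≡ᵇ q k q≡k))

  eastCell-column : ∀ i b → b < k * 3 → eastCell (i , column b) ≡ (i , column (suc b))
  eastCell-column i b b<3k with column b | index-column b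
  ... | (q , r₀) | refl =
    eastCell-r₀ (_≡ (i , q , r₁)) i q (λ { refl → ⊥-elim (<-irrefl refl b<3k) }) (λ _ → refl)
  ... | (q , r₁) | _ = refl
  ... | (q , r₂) | _ = refl

  westCell-nextColumn : ∀ i c → westCell (i , nextColumn c) ≡ (i , c)
  westCell-nextColumn i (q , r₀) = refl
  westCell-nextColumn i (q , r₁) = refl
  westCell-nextColumn i (q , r₂) = refl

  cell-east : (v : Vertex m (suc (k * 3))) → cell (east v) ≡ eastCell (cell v)
  cell-east (i , j) with nextF j in nextj
  ... | just j′ =
    trans (cong (λ b → (i , column b)) (toℕ-nextF-just nextj))
          (sym (eastCell-column i (toℕ j) (s≤s⁻¹ (subst (_< suc (k * 3)) (toℕ-nextF-just nextj) (toℕ<n j′)))))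
  ... | nothing rewrite suc-injective (toℕ-nextF-nothing nextj) | column-*3 k =
    eastCell-r₀ ((sucMod i , 0 , r₀) ≡_) i k (λ _ → refl) (λ k≢k → ⊥-elim (k≢k refl))

  cell-west : (v : Vertex m (suc (k * 3))) → cell (west v) ≡ westCell (cell v)
  cell-west (i , zero) rewrite toℕ-fromℕ (k * 3) | column-*3 k = refl
  cell-west (i , suc j) rewrite toℕ-inject₁ j = sym (westCell-nextColumn i (column (toℕ j)))

-- Row types and activation times

data RowType : Set where
  A₀ A B B′ C : RowType

data Next : RowType → RowType → Set where
  A₀B : Next A₀ B
  A₀B′ : Next A₀ B′
  AB : Next A B
  AB′ : Next A B′
  BA : Next B A
  B′C : Next B′ C
  CA₀ : Next C A₀

Next-A₀ : ∀ {t} → Next t A₀ → t ≡ C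
Next-A₀ CA₀ = refl

seed : RowType → Column → Bool
seed A₀ (_ , r₀) = true
seed A₀ (zero , r₁) = true
seed A (_ , r₀) = true
seed B (_ , r₁) = true
seed B′ (_ , r₁) = true
seed C (_ , r₂) = true
seed _ _ = false

module RowSchedule (k : ℕ) (1≤k : 1 ≤ k) {m : ℕ} (rowType : Fin (suc m) → RowType)
                   (rowType-zero : rowType zero ≡ A₀) (cyclic : IsCyclic Next rowType) where

  -- Block q of three columns is completed around time wave q, the rightmost block first;
  -- late i q is when the residue-2 cell of block q in row i activates.
  wave : ℕ → ℕ
  wave x = (k ∸ x) * (suc m + 4)

  late : Fin (suc m) → ℕ → ℕ
  late i q = 3 + wave (suc q) + (suc m ∸ toℕ i)

  time : RowType → Fin (suc m) → Column → ℕ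
  time A₀ i (q , r₂) = late i q
  time A₀ i (suc q , r₁) = wave (suc q)
  time A i (q , r₁) = 1
  time A i (q , r₂) = late i q
  time B i (q , r₀) = 1
  time B i (q , r₂) = late i q
  time B′ i (q , r₂) = late i q
  time B′ i (zero , r₀) = 1
  time B′ i (suc q , r₀) = 3 + wave (suc q)
  time C i (zero , r₀) = 2
  time C i (suc q , r₀) = 2 + wave (suc q)
  time C i (zero , r₁) = 1
  time C i (suc q , r₁) = 1 + wave (suc q)
  time _ _ _ = 0   -- the seeds, whose time is never consulted

  Good : Cell (suc m) → ℕ → Set
  Good (i , c) x = seed (rowType i) c ≡ true ⊎ time (rowType i) i c < x

  seeded : ∀ {i c t x} → rowType i ≡ t → seed t c ≡ true → Good (i , c) x
  seeded refl = inj₁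

  earlier : ∀ {i c t x} → rowType i ≡ t → time t i c < x → Good (i , c) x
  earlier refl = inj₂

  EarlyNeighbours : RowType → Cell (suc m) → Set
  EarlyNeighbours t (i , c) =
    ThreeOfFour (Good (sucMod i , c) x) (Good (predMod i , c) x)
                (Good (eastCell k (i , c)) x) (Good (westCell k (i , c)) x)
    where x = time t i c

  -- Only a C-row is followed by the wrap-around to row 0, which is an A₀-row.
  sucMod-toℕ : ∀ i → rowType i ≢ C → toℕ (sucMod i) ≡ suc (toℕ i)
  sucMod-toℕ i ≢C with nextF i in nexti | cyclic i
  ... | just j | _ = toℕ-nextF-just nexti
  ... | nothing | next rewrite rowType-zero = ⊥-elim (≢C (Next-A₀ next))

  late-south< : ∀ {i t} q → rowType i ≡ t → t ≢ C → late (sucMod i) q < late i q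
  late-south< {i} q refl ≢C = +-monoʳ-< (3 + wave (suc q))
    (∸-monoʳ-< (subst (toℕ i <_) (sym (sucMod-toℕ i ≢C)) (n<1+n _)) (<⇒≤ (toℕ<n (sucMod i))))

  wave<late : ∀ i q → 3 + wave (suc q) < late i q
  wave<late i q = m<m+n (3 + wave (suc q)) (m<n⇒0<n∸m (toℕ<n i))

  wave-step : ∀ q → q < k → wave q ≡ wave (suc q) + (suc m + 4)
  wave-step q q<k = begin
    (k ∸ q) * (suc m + 4)                   ≡⟨ cong (_* (suc m + 4)) (+-∸-assoc 1 q<k) ⟩
    (suc m + 4) + (k ∸ suc q) * (suc m + 4) ≡⟨ +-comm (suc m + 4) _ ⟩
    wave (suc q) + (suc m + 4)              ∎
    where open ≡-Reasoning

  late<wave : ∀ i q → suc q < k → late i (suc q) < wave (suc q)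
  late<wave i q q+1<k = begin-strict
    3 + wave (suc (suc q)) + (suc m ∸ toℕ i) ≤⟨ +-monoʳ-≤ (3 + wave (suc (suc q))) (m∸n≤m (suc m) (toℕ i)) ⟩
    3 + wave (suc (suc q)) + suc m           <⟨ n<1+n _ ⟩
    suc (3 + wave (suc (suc q)) + suc m)     ≡⟨ arithmetic (wave (suc (suc q))) (suc m) ⟩
    wave (suc (suc q)) + (suc m + 4)         ≡⟨ wave-step (suc q) q+1<k ⟨
    wave (suc q)                             ∎
    where
      open ≤-Reasoning
      arithmetic : ∀ w n → suc (3 + w + n) ≡ w + (n + 4)
      arithmetic = solve-∀

  HasEarlyNeighbours : RowType → Set
  HasEarlyNeighbours t =
    ∀ {i u d} c → rowType i ≡ t → rowType (predMod i) ≡ u → rowType (sucMod i) ≡ d →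
    Next u t → Next t d → index c ≤ k * 3 → seed t c ≡ false → EarlyNeighbours t (i , c)

  k≢0 : 0 ≢ k
  k≢0 = <⇒≢ 1≤k

  early-A₀ : HasEarlyNeighbours A₀
  early-A₀ (q , r₀) _ _ _ _ _ _ ()
  early-A₀ (zero , r₁) _ _ _ _ _ _ ()
  early-A₀ {i} (suc q , r₁) e _ ed CA₀ A₀B bound _ =
    skip₂ (seeded ed refl) (earlier e (late<wave i q (*-cancelʳ-< 3 (suc q) k bound))) (seeded e refl)
  early-A₀ {i} (suc q , r₁) e _ ed CA₀ A₀B′ bound _ =
    skip₂ (seeded ed refl) (earlier e (late<wave i q (*-cancelʳ-< 3 (suc q) k bound))) (seeded e refl)
  early-A₀ (q , r₂) e eu ed CA₀ A₀B _ _ =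
    skip₄ (earlier ed (late-south< q e λ ())) (seeded eu refl) (seeded e refl)
  early-A₀ (q , r₂) e eu ed CA₀ A₀B′ _ _ =
    skip₄ (earlier ed (late-south< q e λ ())) (seeded eu refl) (seeded e refl)

  early-A : HasEarlyNeighbours A
  early-A (q , r₀) _ _ _ _ _ _ ()
  early-A (q , r₁) e eu ed BA AB _ _ = skip₃ (seeded ed refl) (seeded eu refl) (seeded e refl)
  early-A (q , r₁) e eu ed BA AB′ _ _ = skip₃ (seeded ed refl) (seeded eu refl) (seeded e refl)
  early-A (q , r₂) e _ ed BA AB _ _ =
    skip₂ (earlier ed (late-south< q e λ ())) (seeded e refl) (earlier e (s≤s (s≤s z≤n)))
  early-A (q , r₂) e _ ed BA AB′ _ _ =
    skip₂ (earlier ed (late-south< q e λ ())) (seeded e refl) (earlier e (s≤s (s≤s z≤n)))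

  early-B : HasEarlyNeighbours B
  early-B (q , r₁) _ _ _ _ _ _ ()
  early-B {i} (q , r₀) e eu ed A₀B BA _ _ =
    skip₄ (seeded ed refl) (seeded eu refl)
          (eastCell-r₀ k (λ d → Good d 1) i q (λ _ → seeded ed refl) (λ _ → seeded e refl))
  early-B {i} (q , r₀) e eu ed AB BA _ _ =
    skip₄ (seeded ed refl) (seeded eu refl)
          (eastCell-r₀ k (λ d → Good d 1) i q (λ _ → seeded ed refl) (λ _ → seeded e refl))
  early-B (q , r₂) e _ ed _ BA _ _ =
    skip₂ (earlier ed (late-south< q e λ ())) (earlier e (s≤s (s≤s z≤n))) (seeded e refl)

  early-B′ : HasEarlyNeighbours B′
  early-B′ (q , r₁) _ _ _ _ _ _ ()
  early-B′ {i} (zero , r₀) e eu _ A₀B′ B′C _ _ =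
    skip₁ (seeded eu refl) (eastCell-r₀ k (λ d → Good d 1) i 0 (⊥-elim ∘ k≢0) (λ _ → seeded e refl))
          (seeded eu refl)
  early-B′ {i} (zero , r₀) e eu _ AB′ B′C _ _ =
    skip₁ (seeded eu refl) (eastCell-r₀ k (λ d → Good d 1) i 0 (⊥-elim ∘ k≢0) (λ _ → seeded e refl))
          (seeded eu refl)
  early-B′ {i} (suc q , r₀) e eu ed A₀B′ B′C _ _ =
    skip₄ (earlier ed (n<1+n _)) (seeded eu refl)
          (eastCell-r₀ k (λ d → Good d (3 + wave (suc q))) i (suc q)
                       (λ _ → earlier ed (m≤m+n 3 _)) (λ _ → seeded e refl))
  early-B′ {i} (suc q , r₀) e eu ed AB′ B′C _ _ =
    skip₄ (earlier ed (n<1+n _)) (seeded eu refl)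
          (eastCell-r₀ k (λ d → Good d (3 + wave (suc q))) i (suc q)
                       (λ _ → earlier ed (m≤m+n 3 _)) (λ _ → seeded e refl))
  early-B′ {i} (q , r₂) e _ ed _ B′C _ _ =
    skip₂ (seeded ed refl) (earlier e (wave<late i q)) (seeded e refl)

  early-C : HasEarlyNeighbours C
  early-C (q , r₂) _ _ _ _ _ _ ()
  early-C {i} (zero , r₀) e eu ed B′C CA₀ _ _ =
    skip₄ (seeded ed refl) (earlier eu (n<1+n 1))
          (eastCell-r₀ k (λ d → Good d 2) i 0 (⊥-elim ∘ k≢0) (λ _ → earlier e (n<1+n 1)))
  early-C {i} (suc q , r₀) e _ ed B′C CA₀ _ _ =
    skip₂ (seeded ed refl)
          (eastCell-r₀ k (λ d → Good d (2 + wave (suc q))) i (suc q)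
                       (λ _ → seeded ed refl) (λ _ → earlier e (n<1+n _)))
          (seeded e refl)
  early-C (zero , r₁) e eu ed B′C CA₀ _ _ =
    skip₄ (seeded ed refl) (seeded eu refl) (seeded e refl)
  early-C (suc q , r₁) e eu ed B′C CA₀ _ _ =
    skip₄ (earlier ed (n<1+n _)) (seeded eu refl) (seeded e refl)

  early : ∀ t → HasEarlyNeighbours t
  early A₀ = early-A₀
  early A = early-A
  early B = early-B
  early B′ = early-B′
  early C = early-C

  seeds : VSet (suc m) (suc (k * 3))
  seeds (i , j) = seed (rowType i) (column (toℕ j))

  activation : Vertex (suc m) (suc (k * 3)) → ℕ
  activation (i , j) = time (rowType i) i (column (toℕ j))

  good⇒earlier : ∀ v u {d} → cell u ≡ d → Good d (activation v) → EarlierThan 3 seeds activation v u ≡ true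
  good⇒earlier v u refl (inj₁ seeded) = cong (_∨ (activation u <ᵇ activation v)) seeded
  good⇒earlier v u refl (inj₂ before) =
    trans (cong (seeds u ∨_) (Equivalence.to T-≡ (<⇒<ᵇ before))) (∨-zeroʳ (seeds u))

  schedule : IsSchedule 3 seeds activation
  schedule v@(i , j) seedless =
    3≤activeNbrs (EarlierThan 3 seeds activation v) v
      (ThreeOfFour-map (good⇒earlier v (south v) refl) (good⇒earlier v (north v) refl)
                       (good⇒earlier v (east v) (cell-east k v)) (good⇒earlier v (west v) (cell-west k v))
                       (early (rowType i) (column (toℕ j)) refl refl refl (cyclic-predMod {R = Next} cyclic i) (cyclic i)
                              (subst (_≤ k * 3) (sym (index-column (toℕ j))) (s≤s⁻¹ (toℕ<n j))) seedless))

  percolates : Percolates 3 seeds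
  percolates = schedule⇒percolates 3 seeds activation schedule

-- Counting seeds

rowCount : ℕ → RowType → ℕ
rowCount k t = countBelow (λ b → seed t (column b)) (suc (k * 3))

countBelow-periodic : ∀ (p : ℕ → Bool) → (∀ b → p (3 + b) ≡ p b) → ∀ k →
                      countBelow p (suc (k * 3)) ≡ toℕᵇ (p 0) + k * (toℕᵇ (p 0) + (toℕᵇ (p 1) + toℕᵇ (p 2)))
countBelow-periodic p periodic zero = refl
countBelow-periodic p periodic (suc k) =
  trans (cong (λ c → x + (y + (z + c))) (trans (countBelow-cong periodic (suc (k * 3))) (countBelow-periodic p periodic k)))
        (arithmetic x y z k)
  where
    x = toℕᵇ (p 0); y = toℕᵇ (p 1); z = toℕᵇ (p 2)
    arithmetic : ∀ x y z k → x + (y + (z + (x + k * (x + (y + z))))) ≡ x + suc k * (x + (y + z))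
    arithmetic = solve-∀

column-3+ : ∀ b → column (3 + b) ≡ (suc (proj₁ (column b)) , proj₂ (column b))
column-3+ b with column b
... | (q , r₀) = refl
... | (q , r₁) = refl
... | (q , r₂) = refl

seed-suc : ∀ t → t ≢ A₀ → ∀ q r → seed t (suc q , r) ≡ seed t (q , r)
seed-suc A₀ ≢A₀ q r = ⊥-elim (≢A₀ refl)
seed-suc A _ q r₀ = refl
seed-suc A _ q r₁ = refl
seed-suc A _ q r₂ = refl
seed-suc B _ q r₀ = refl
seed-suc B _ q r₁ = refl
seed-suc B _ q r₂ = refl
seed-suc B′ _ q r₀ = refl
seed-suc B′ _ q r₁ = refl
seed-suc B′ _ q r₂ = refl
seed-suc C _ q r₀ = refl
seed-suc C _ q r₁ = refl
seed-suc C _ q r₂ = refl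

seed-A₀-suc : ∀ q r → seed A₀ (suc q , r) ≡ seed A (q , r)
seed-A₀-suc q r₀ = refl
seed-A₀-suc q r₁ = refl
seed-A₀-suc q r₂ = refl

rowCount-periodic : ∀ t → t ≢ A₀ → ∀ k →
                    rowCount k t ≡ toℕᵇ (seed t (0 , r₀))
                                   + k * (toℕᵇ (seed t (0 , r₀)) + (toℕᵇ (seed t (0 , r₁)) + toℕᵇ (seed t (0 , r₂))))
rowCount-periodic t ≢A₀ = countBelow-periodic _ (λ b → trans (cong (seed t) (column-3+ b)) (seed-suc t ≢A₀ _ _))

rowCount-A : ∀ k → rowCount k A ≡ suc k
rowCount-A k = trans (rowCount-periodic A (λ ()) k) (cong suc (*-identityʳ k))

seedsPerRow : ℕ → RowType → ℕ
seedsPerRow k A₀ = 2 + k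
seedsPerRow k A = 1 + k
seedsPerRow k _ = k

rowCount-suc : ∀ k t → rowCount (suc k) t ≡ seedsPerRow (suc k) t
rowCount-suc k A₀ =
  cong (2 +_) (trans (countBelow-cong (λ b → trans (cong (seed A₀) (column-3+ b)) (seed-A₀-suc _ _)) (suc (k * 3)))
                     (rowCount-A k))
rowCount-suc k A = rowCount-A (suc k)
rowCount-suc k B = trans (rowCount-periodic B (λ ()) (suc k)) (*-identityʳ (suc k))
rowCount-suc k B′ = trans (rowCount-periodic B′ (λ ()) (suc k)) (*-identityʳ (suc k))
rowCount-suc k C = trans (rowCount-periodic C (λ ()) (suc k)) (*-identityʳ (suc k))

chain-rows : ∀ {u rest} → Next u B → Next u B′ → Chain Next A₀ B′ rest →
             ∀ h → Chain Next A₀ u (alternate h B A ++ B′ ∷ rest)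
chain-rows uB uB′ chain zero = uB′ , chain
chain-rows uB uB′ chain (suc h) = uB , BA , chain-rows AB AB′ chain h

rowWord-seed : ∀ {m} k (ws : List RowType) → Chain Next A₀ A₀ ws → m ≡ suc (length ws) →
               Σ (VSet m (suc (suc k * 3))) λ S → Percolates 3 S × size S ≡ sum (map (seedsPerRow (suc k)) (A₀ ∷ ws))
rowWord-seed k ws chain m≡ =
  map₂ (map₂ (λ size≡ → trans size≡ (cong sum (map-cong (rowCount-suc k) (A₀ ∷ ws)))))
       (rowPattern-seed (A₀ ∷ ws) (λ t b → seed t (column b)) m≡
          (RowSchedule.percolates (suc k) (s≤s z≤n) (lookup (A₀ ∷ ws)) refl (chain⇒cyclic {R = Next} {xs = ws} chain)))

evenRows-seed : ∀ h k → Σ (VSet (6 + h * 2) (suc (suc k * 3))) λ S →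
                Percolates 3 S × 6 * size S ≡ 2 * ((6 + h * 2) * suc (suc k * 3)) + (6 + h * 2) + 6
evenRows-seed h k =
  map₂ (map₂ count⇒bound)
       (rowWord-seed k rows (chain-rows A₀B A₀B′ (B′C , CA₀ , A₀B′ , B′C , CA₀) h)
          (cong suc (trans (+-comm 5 (h * 2)) (sym (length-alternate-++ h B A _)))))
  where
    rows : List RowType
    rows = alternate h B A ++ B′ ∷ C ∷ A₀ ∷ B′ ∷ C ∷ []
    arithmetic : ∀ h k → 6 * (3 + k + (h * (suc k + (2 + k)) + (suc k + (suc k + (3 + k + (suc k + (suc k + 0)))))))
                       ≡ 2 * ((6 + h * 2) * suc (suc k * 3)) + (6 + h * 2) + 6
    arithmetic = solve-∀
    count⇒bound : ∀ {s} → s ≡ sum (map (seedsPerRow (suc k)) (A₀ ∷ rows)) →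
                  6 * s ≡ 2 * ((6 + h * 2) * suc (suc k * 3)) + (6 + h * 2) + 6
    count⇒bound refl = trans (cong (λ c → 6 * (3 + k + c)) (sum-map-alternate-++ (seedsPerRow (suc k)) h B A _))
                             (arithmetic h k)

oddRows-seed : ∀ h k → Σ (VSet (3 + h * 2) (suc (suc k * 3))) λ S →
               Percolates 3 S × 6 * size S + 3 ≡ 2 * ((3 + h * 2) * suc (suc k * 3)) + (3 + h * 2) + 6
oddRows-seed h k =
  map₂ (map₂ count⇒bound)
       (rowWord-seed k rows (chain-rows A₀B A₀B′ (B′C , CA₀) h)
          (cong suc (trans (+-comm 2 (h * 2)) (sym (length-alternate-++ h B A _)))))
  where
    rows : List RowType
    rows = alternate h B A ++ B′ ∷ C ∷ []
    arithmetic : ∀ h k → 6 * (3 + k + (h * (suc k + (2 + k)) + (suc k + (suc k + 0)))) + 3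
                       ≡ 2 * ((3 + h * 2) * suc (suc k * 3)) + (3 + h * 2) + 6
    arithmetic = solve-∀
    count⇒bound : ∀ {s} → s ≡ sum (map (seedsPerRow (suc k)) (A₀ ∷ rows)) →
                  6 * s + 3 ≡ 2 * ((3 + h * 2) * suc (suc k * 3)) + (3 + h * 2) + 6
    count⇒bound refl = trans (cong (λ c → 6 * (3 + k + c) + 3) (sum-map-alternate-++ (seedsPerRow (suc k)) h B A _))
                             (arithmetic h k)

percolatingSet-n≡1+k*3 : ∀ {m k} → 6 ≤ m → 1 ≤ k →
                         Σ (VSet m (suc (k * 3))) λ S → Percolates 3 S × 6 * size S ≤ 2 * (m * suc (k * 3)) + m + 6
percolatingSet-n≡1+k*3 {k = suc k} 6≤m _ with m≤n⇒∃[o]m+o≡n 6≤m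
... | m′ , refl with even⊎odd m′
...   | inj₁ (h , refl) = map₂ (map₂ ≤-reflexive) (evenRows-seed h k)
...   | inj₂ (p , refl) = map₂ (λ {S} → map₂ (λ eq → subst (6 * size S ≤_) eq (m≤m+n _ 3))) (oddRows-seed (2 + p) k)

percolatingSet : ∀ {m n} → 8 ≤ m → n % 3 ≡ 1 →
                 Σ (VSet m n) λ S → Percolates 3 S × 6 * size S ≤ 2 * (m * n) + m + 6
percolatingSet {m} {n} 8≤m n%3≡1 with n / 3 | trans (m≡m%n+[m/n]*n n 3) (cong (_+ (n / 3) * 3) n%3≡1)
... | suc k | refl = percolatingSet-n≡1+k*3 {k = suc k} (≤-trans (m≤n+m 6 2) 8≤m) (s≤s z≤n)
... | zero | refl = map₂ (λ {S} → map₂ (tripled (size S))) (percolatingSet-n≡1 m)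
  where
    arithmetic : ∀ m → 3 * (2 + m) ≡ 2 * (m * 1) + m + 6
    arithmetic = solve-∀
    tripled : ∀ s → 2 * s ≤ 2 + m → 6 * s ≤ 2 * (m * 1) + m + 6
    tripled s bound = begin
      6 * s                ≡⟨ *-assoc 3 2 s ⟩
      3 * (2 * s)          ≤⟨ *-monoʳ-≤ 3 bound ⟩
      3 * (2 + m)          ≡⟨ arithmetic m ⟩
      2 * (m * 1) + m + 6  ∎
      where open ≤-Reasoning

theorem3p3 : (m n s : ℕ) → 8 ≤ m → 1 ≤ n → n % 3 ≡ 1 →
    IsMinSeed m n 3 s → 6 * s ≤ 2 * (m * n) + m + 6
theorem3p3 m n s 8≤m _ n%3≡1 (_ , minimal) =
  let S , percolates , bound = percolatingSet 8≤m n%3≡1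
  in ≤-trans (*-monoʳ-≤ 6 (minimal S percolates)) bound
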